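{- Let $G$ be a finite simple graph with no isolated vertices, vertex set $\{v_1,\dots,v_n\}$, and let $T$ be a minimum twin cover of $G$. Let $t\in\mathbb{N}$. Then the set \[ T^{(t)} = \{u_i^s \mid v_i \in T,\ 0 \le s \le t\} \] is a minimum twin cover of $\mu^{(t)}(G)$, of size $(t+1)|T|$.
   Context: For $t \in \mathbb{N}$ and a graph $G$ with $V(G)=\{v_1,\dots,v_n\}$, the generalized Mycielskian $\mu^{(t)}(G)$ has vertex set $\{u_i^s : 1\le i\le n,\ 0\le s\le t\} \cup \{w\}$, with $u_i^0$ identified with $v_i$. For each edge $v_iv_j$ of $G$ it has edges $u_i^0u_j^0$ and $u_i^su_j^{s+1}$, $u_j^su_i^{s+1}$ for $0 \le s < t$; also edges $u_i^t w$ for $1 \le i \le n$; no other edges. Two vertices are twins if they have the same open neighborhood. A minimum twin cover of a graph is a minimum size subset of its vertices containing at least one vertex from every pair of twin vertices. -}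

module Defs where

open import Data.Nat using (ℕ; zero; suc; _*_; _≡ᵇ_; _≤_)
open import Data.Fin using (Fin; zero; suc; toℕ; remQuot; combine)
open import Data.Fin.Subset using (Subset; _∈_; ∣_∣)
open import Data.Bool using (Bool; true; false; _∧_; _∨_)
open import Data.Vec using (Vec; tabulate; lookup)
open import Data.Product using (_×_; ∃; _,_)
open import Data.Sum using (_⊎_)
open import Relation.Binary.PropositionalEquality using (_≡_; _≢_)

record Graph (n : ℕ) : Set where
  field
    adj    : Fin n → Fin n → Bool
    sym    : ∀ i j → adj i j ≡ adj j i
    irrefl : ∀ i → adj i i ≡ false
open Graph public

NoIsolated : ∀ {n} → Graph n → Set
NoIsolated G = ∀ i → ∃ λ j → adj G i j ≡ true

Twins : ∀ {N} → (Fin N → Fin N → Bool) → Fin N → Fin N → Set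
Twins A x y = x ≢ y × (∀ z → A x z ≡ A y z)

IsTwinCover : ∀ {N} → (Fin N → Fin N → Bool) → Subset N → Set
IsTwinCover A S = ∀ x y → Twins A x y → x ∈ S ⊎ y ∈ S

IsMinTwinCover : ∀ {N} → (Fin N → Fin N → Bool) → Subset N → Set
IsMinTwinCover A S = IsTwinCover A S × (∀ S′ → IsTwinCover A S′ → ∣ S ∣ ≤ ∣ S′ ∣)

-- Vertices of μ^(t)(G): Fin (suc (suc t * n)).
--   zero                        ↦ w
--   suc (combine s i)           ↦ u_i^s   (s : Fin (suc t), i : Fin n), u_i^0 = v_i
MVert : ℕ → ℕ → ℕ
MVert t n = suc (suc t * n)

uvert : ∀ {t n} → Fin (suc t) → Fin n → Fin (MVert t n)
uvert s i = suc (combine s i)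

levelAdj : ∀ {t} → Fin (suc t) → Fin (suc t) → Bool
levelAdj s r = ((toℕ s ≡ᵇ 0) ∧ (toℕ r ≡ᵇ 0))
             ∨ (suc (toℕ s) ≡ᵇ toℕ r) ∨ (suc (toℕ r) ≡ᵇ toℕ s)

muAdj : ∀ {n} (t : ℕ) → Graph n → Fin (MVert t n) → Fin (MVert t n) → Bool
muAdj t G zero zero = false
muAdj {n} t G zero (suc y) with remQuot {suc t} n y
... | (r , j) = toℕ r ≡ᵇ t
muAdj {n} t G (suc x) zero with remQuot {suc t} n x
... | (s , i) = toℕ s ≡ᵇ t
muAdj {n} t G (suc x) (suc y) with remQuot {suc t} n x | remQuot {suc t} n y
... | (s , i) | (r , j) = levelAdj s r ∧ adj G i j

liftCover : ∀ {n} (t : ℕ) → Subset n → Subset (MVert t n)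
liftCover {n} t T = tabulate f
  where
    f : Fin (MVert t n) → Bool
    f zero = false
    f (suc x) with remQuot {suc t} n x
    ... | (s , i) = lookup T i

-- In μ^(t)(G) the apex w is nobody's twin, and u_i^s, u_j^r can be twins only when s = r: since
-- v_i has a neighbour v_k, the vertex u_i^s is adjacent to u_k^b for a level b next to s that
-- is not next to r (b = s − 1, or b = 1 when s = 0 and r = 1). On a fixed level, u_i^s and
-- u_j^s are twins exactly when v_i and v_j are. So T^(t) is a twin cover, and every twin cover
-- meets each of the t + 1 levels in a twin cover of G, hence has at least (t + 1)|T| vertices.
module Submission where

open import Defs hiding (sym)
open import Data.Nat using (ℕ; suc; _*_)
open import Data.Fin.Subset using (Subset; ∣_∣)
open import Data.Product using (_×_)
open import Relation.Binary.PropositionalEquality using (_≡_)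

open import Data.Bool using (true; false; _∧_)
open import Data.Bool.Properties using (∨-zeroʳ)
open import Data.Empty using (⊥-elim)
open import Data.Fin using (Fin; zero; suc; toℕ; pred; inject₁; combine; remQuot)
open import Data.Fin.Properties using (toℕ-inject₁; toℕ-injective; remQuot-combine; combine-remQuot; combine-surjective; combine-injectiveʳ; suc-injective; toℕ≤pred[n])
open import Data.Fin.Subset using (_∈_; inside; outside)
open import Data.Fin.Subset.Properties using (drop-there; ∣p∣≤∣x∷p∣)
open import Data.Nat using (zero; _+_; _≟_; _≤_; _<_; _≡ᵇ_; s≤s; z≤n)
open import Data.Nat.Properties using (<-cmp; <-irrefl; <-trans; n<1+n; +-mono-≤; module ≤-Reasoning)
open import Data.Product using (∃; _,_; proj₁; proj₂)
open import Data.Sum using (map)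
open import Data.Vec using (Vec; []; _∷_; there; _++_; concat; replicate; lookup; tabulate; group)
open import Data.Vec.Properties using (lookup-concat; lookup-replicate; tabulate-cong; tabulate∘lookup; lookup∘tabulate; []=⇒lookup; lookup⇒[]=)
open import Function using (_∘_)
open import Relation.Binary.Definitions using (tri<; tri≈; tri>)
open import Relation.Binary.PropositionalEquality using (_≢_; refl; sym; trans; cong; cong₂; subst; module ≡-Reasoning)
open import Relation.Nullary using (¬_; yes; no)

≡ᵇ-refl : ∀ m → (m ≡ᵇ m) ≡ true
≡ᵇ-refl zero    = refl
≡ᵇ-refl (suc m) = ≡ᵇ-refl m

≢⇒≡ᵇ≡false : ∀ {m n} → m ≢ n → (m ≡ᵇ n) ≡ false
≢⇒≡ᵇ≡false {zero}  {zero}  m≢n = ⊥-elim (m≢n refl)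
≢⇒≡ᵇ≡false {zero}  {suc n} m≢n = refl
≢⇒≡ᵇ≡false {suc m} {zero}  m≢n = refl
≢⇒≡ᵇ≡false {suc m} {suc n} m≢n = ≢⇒≡ᵇ≡false (m≢n ∘ cong suc)

≡⇒≡ᵇ≡true : ∀ {m n} → m ≡ n → (m ≡ᵇ n) ≡ true
≡⇒≡ᵇ≡true {m} refl = ≡ᵇ-refl m

true≢false : true ≢ false
true≢false ()

toℕ-pred≢top : ∀ {t} (r : Fin (suc t)) → toℕ r ≢ t → toℕ (pred r) ≢ t
toℕ-pred≢top zero    r≢t = r≢t
toℕ-pred≢top (suc r) _   = λ r≡t → <-irrefl (trans (sym (toℕ-inject₁ r)) r≡t) (toℕ≤pred[n] (suc r))

levelAdj-pred : ∀ {t} (s : Fin (suc t)) → levelAdj s (pred s) ≡ true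
levelAdj-pred zero    = refl
levelAdj-pred (suc s) rewrite toℕ-inject₁ s | ≡ᵇ-refl (toℕ s) = ∨-zeroʳ _

separatingLevel : ∀ {t} {s r : Fin (suc t)} → toℕ s < toℕ r →
                  ∃ λ b → levelAdj s b ≡ true × levelAdj r b ≡ false
separatingLevel {s = zero}  {suc zero}    _ = suc zero , refl , refl
separatingLevel {s = zero}  {suc (suc r)} _ = zero , refl , refl
separatingLevel {s = suc s} {suc r} (s≤s s<r) = inject₁ s , levelAdj-pred (suc s) , far
  where
    far : levelAdj (suc r) (inject₁ s) ≡ false
    far rewrite toℕ-inject₁ s
              | ≢⇒≡ᵇ≡false (λ e → <-irrefl (sym e) (<-trans s<r (<-trans (n<1+n _) (n<1+n _))))
              | ≢⇒≡ᵇ≡false (λ e → <-irrefl e s<r) = refl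

∣p++q∣ : ∀ {m n} (p : Subset m) (q : Subset n) → ∣ p ++ q ∣ ≡ ∣ p ∣ + ∣ q ∣
∣p++q∣ []            q = refl
∣p++q∣ (inside  ∷ p) q = cong suc (∣p++q∣ p q)
∣p++q∣ (outside ∷ p) q = ∣p++q∣ p q

∣concat-replicate∣ : ∀ {n} m (p : Subset n) → ∣ concat (replicate m p) ∣ ≡ m * ∣ p ∣
∣concat-replicate∣ zero    p = refl
∣concat-replicate∣ (suc m) p = trans (∣p++q∣ p _) (cong (∣ p ∣ +_) (∣concat-replicate∣ m p))

m*c≤∣concat∣ : ∀ {m n c} (ps : Vec (Subset n) m) → (∀ s → c ≤ ∣ lookup ps s ∣) → m * c ≤ ∣ concat ps ∣
m*c≤∣concat∣ []       c≤ = z≤n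
m*c≤∣concat∣ {suc m} {c = c} (p ∷ ps) c≤ = begin
  c + m * c             ≤⟨ +-mono-≤ (c≤ zero) (m*c≤∣concat∣ ps (c≤ ∘ suc)) ⟩
  ∣ p ∣ + ∣ concat ps ∣ ≡⟨ sym (∣p++q∣ p (concat ps)) ⟩
  ∣ p ++ concat ps ∣ ∎
  where open ≤-Reasoning

∈-concat⁺ : ∀ {m n} {ps : Vec (Subset n) m} {s x} → x ∈ lookup ps s → combine s x ∈ concat ps
∈-concat⁺ {ps = ps} {s} {x} x∈p = lookup⇒[]= _ _ (trans (lookup-concat ps s x) ([]=⇒lookup x∈p))

∈-concat⁻ : ∀ {m n} {ps : Vec (Subset n) m} {s x} → combine s x ∈ concat ps → x ∈ lookup ps s
∈-concat⁻ {ps = ps} {s} {x} x∈ps = lookup⇒[]= _ _ (trans (sym (lookup-concat ps s x)) ([]=⇒lookup x∈ps))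

lookup-injective : ∀ {a} {A : Set a} {n} {u v : Vec A n} → (∀ i → lookup u i ≡ lookup v i) → u ≡ v
lookup-injective {u = u} {v} u≗v = begin
  u                    ≡⟨ tabulate∘lookup u ⟨
  tabulate (lookup u)  ≡⟨ tabulate-cong u≗v ⟩
  tabulate (lookup v)  ≡⟨ tabulate∘lookup v ⟩
  v                    ∎
  where open ≡-Reasoning

liftCover≡ : ∀ {n} t (T : Subset n) → liftCover t T ≡ outside ∷ concat (replicate (suc t) T)
liftCover≡ {n} t T = lookup-injective λ where
    zero    → refl
    (suc x) → trans (lookup∘tabulate (λ y → lookup T (proj₂ (remQuot {suc t} n y))) x) (sym (entry x))
  where
    open ≡-Reasoning
    Ts = replicate (suc t) T
    entry : ∀ x → lookup (concat Ts) x ≡ lookup T (proj₂ (remQuot {suc t} n x))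
    entry x = begin
      lookup (concat Ts) x              ≡⟨ cong (lookup (concat Ts)) (combine-remQuot {suc t} n x) ⟨
      lookup (concat Ts) (combine s i)  ≡⟨ lookup-concat Ts s i ⟩
      lookup (lookup Ts s) i            ≡⟨ cong (λ p → lookup p i) (lookup-replicate s T) ⟩
      lookup T i                        ∎
      where
        s = proj₁ (remQuot {suc t} n x)
        i = proj₂ (remQuot {suc t} n x)

∣liftCover∣ : ∀ {n} t (T : Subset n) → ∣ liftCover t T ∣ ≡ suc t * ∣ T ∣
∣liftCover∣ t T = trans (cong ∣_∣ (liftCover≡ t T)) (∣concat-replicate∣ (suc t) T)

∈-liftCover : ∀ {n t} {T : Subset n} {s i} → i ∈ T → uvert {t} s i ∈ liftCover t T
∈-liftCover {t = t} {T} {s} {i} i∈T rewrite liftCover≡ t T =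
  there (∈-concat⁺ {ps = replicate (suc t) T} {s} (subst (i ∈_) (sym (lookup-replicate s T)) i∈T))

module _ {n} (G : Graph n) (t : ℕ) where

  muAdj-uu : ∀ s i r j → muAdj t G (uvert s i) (uvert r j) ≡ (levelAdj s r ∧ adj G i j)
  muAdj-uu s i r j = cong₂ (λ (s′ , i′) (r′ , j′) → levelAdj s′ r′ ∧ adj G i′ j′)
                             (remQuot-combine {suc t} {n} s i) (remQuot-combine r j)

  muAdj-wu : ∀ r j → muAdj t G zero (uvert r j) ≡ (toℕ r ≡ᵇ t)
  muAdj-wu r j = cong (λ (r′ , _) → toℕ r′ ≡ᵇ t) (remQuot-combine {suc t} {n} r j)

  muAdj-uw : ∀ s i → muAdj t G (uvert s i) zero ≡ (toℕ s ≡ᵇ t)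
  muAdj-uw s i = cong (λ (s′ , _) → toℕ s′ ≡ᵇ t) (remQuot-combine {suc t} {n} s i)

  data VertexView : Fin (MVert t n) → Set where
    apex  : VertexView zero
    layer : ∀ s i → VertexView (uvert {t} {n} s i)

  vertexView : ∀ x → VertexView x
  vertexView zero = apex
  vertexView (suc x) with combine-surjective {suc t} {n} x
  ... | s , i , refl = layer s i

  private
    μ = muAdj t G

  twins⇒layer-twins : ∀ {i j} → Twins (adj G) i j → ∀ s → Twins μ (uvert s i) (uvert s j)
  twins⇒layer-twins {i} {j} (i≢j , i≈j) s = i≢j ∘ combine-injectiveʳ s i s j ∘ suc-injective , same
    where
      same : ∀ z → μ (uvert s i) z ≡ μ (uvert s j) z
      same z with vertexView z
      ... | apex      = trans (muAdj-uw s i) (sym (muAdj-uw s j))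
      ... | layer r k = begin
        μ (uvert s i) (uvert r k)  ≡⟨ muAdj-uu s i r k ⟩
        levelAdj s r ∧ adj G i k   ≡⟨ cong (levelAdj s r ∧_) (i≈j k) ⟩
        levelAdj s r ∧ adj G j k   ≡⟨ muAdj-uu s j r k ⟨
        μ (uvert s j) (uvert r k)  ∎
        where open ≡-Reasoning

  module _ (noIsolated : NoIsolated G) where

    apex-not-twin : ∀ r j → ¬ (∀ z → μ zero z ≡ μ (uvert r j) z)
    apex-not-twin r j same with toℕ r ≟ t
    ... | yes r≡t = true≢false (begin
      true                ≡⟨ ≡⇒≡ᵇ≡true r≡t ⟨
      toℕ r ≡ᵇ t          ≡⟨ muAdj-uw r j ⟨
      μ (uvert r j) zero  ≡⟨ same zero ⟨
      false               ∎)
      where open ≡-Reasoning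
    ... | no r≢t with k , jk ← noIsolated j = true≢false (begin
      true                             ≡⟨ cong₂ _∧_ (levelAdj-pred r) jk ⟨
      levelAdj r (pred r) ∧ adj G j k  ≡⟨ muAdj-uu r j (pred r) k ⟨
      μ (uvert r j) (uvert (pred r) k) ≡⟨ same (uvert (pred r) k) ⟨
      μ zero (uvert (pred r) k)        ≡⟨ muAdj-wu (pred r) k ⟩
      toℕ (pred r) ≡ᵇ t                ≡⟨ ≢⇒≡ᵇ≡false (toℕ-pred≢top r r≢t) ⟩
      false                            ∎)
      where open ≡-Reasoning

    different-levels-not-twins : ∀ {s r} i j → toℕ s < toℕ r → ¬ (∀ z → μ (uvert s i) z ≡ μ (uvert r j) z)
    different-levels-not-twins {s} {r} i j s<r same
      with b , s~b , r≁b ← separatingLevel s<r | k , ik ← noIsolated i = true≢false (begin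
      true                       ≡⟨ cong₂ _∧_ s~b ik ⟨
      levelAdj s b ∧ adj G i k   ≡⟨ muAdj-uu s i b k ⟨
      μ (uvert s i) (uvert b k)  ≡⟨ same (uvert b k) ⟩
      μ (uvert r j) (uvert b k)  ≡⟨ muAdj-uu r j b k ⟩
      levelAdj r b ∧ adj G j k   ≡⟨ cong (_∧ adj G j k) r≁b ⟩
      false                      ∎)
      where open ≡-Reasoning

    twins-same-level : ∀ {s r i j} → Twins μ (uvert s i) (uvert r j) → s ≡ r
    twins-same-level {s} {r} {i} {j} (_ , same) with <-cmp (toℕ s) (toℕ r)
    ... | tri< s<r _ _ = ⊥-elim (different-levels-not-twins i j s<r same)
    ... | tri≈ _ s≡r _ = toℕ-injective s≡r
    ... | tri> _ _ r<s = ⊥-elim (different-levels-not-twins j i r<s (sym ∘ same))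

    layer-twins⇒twins : ∀ {s i j} → Twins μ (uvert s i) (uvert s j) → Twins (adj G) i j
    layer-twins⇒twins {s} {i} {j} (ui≢uj , same) = ui≢uj ∘ cong (uvert s) , i≈j
      where
        open ≡-Reasoning
        i≈j : ∀ k → adj G i k ≡ adj G j k
        i≈j k = begin
          adj G i k                            ≡⟨ cong (_∧ adj G i k) (levelAdj-pred s) ⟨
          levelAdj s (pred s) ∧ adj G i k      ≡⟨ muAdj-uu s i (pred s) k ⟨
          μ (uvert s i) (uvert (pred s) k)     ≡⟨ same (uvert (pred s) k) ⟩
          μ (uvert s j) (uvert (pred s) k)     ≡⟨ muAdj-uu s j (pred s) k ⟩
          levelAdj s (pred s) ∧ adj G j k      ≡⟨ cong (_∧ adj G j k) (levelAdj-pred s) ⟩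
          adj G j k                            ∎

    liftCover-isTwinCover : ∀ {T : Subset n} → IsTwinCover (adj G) T → IsTwinCover μ (liftCover t T)
    liftCover-isTwinCover coverT x y twins with vertexView x | vertexView y
    ... | apex      | apex      = ⊥-elim (proj₁ twins refl)
    ... | apex      | layer r j = ⊥-elim (apex-not-twin r j (proj₂ twins))
    ... | layer s i | apex      = ⊥-elim (apex-not-twin s i (sym ∘ proj₂ twins))
    ... | layer s i | layer r j with refl ← twins-same-level {s} {r} {i} {j} twins =
      map (∈-liftCover {s = s}) (∈-liftCover {s = s}) (coverT i j (layer-twins⇒twins {s} twins))

  layer-isTwinCover : ∀ {b} {ps : Vec (Subset n) (suc t)} →
                      IsTwinCover μ (b ∷ concat ps) → ∀ s → IsTwinCover (adj G) (lookup ps s)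
  layer-isTwinCover {ps = ps} cover s i j twins =
    map (∈-concat⁻ {ps = ps} {s} ∘ drop-there) (∈-concat⁻ {ps = ps} {s} ∘ drop-there)
        (cover _ _ (twins⇒layer-twins twins s))

  liftCover-minimum : ∀ {T : Subset n} → (∀ S → IsTwinCover (adj G) S → ∣ T ∣ ≤ ∣ S ∣) →
                      ∀ S → IsTwinCover μ S → ∣ liftCover t T ∣ ≤ ∣ S ∣
  liftCover-minimum {T} minT (b ∷ S) coverS with group (suc t) n S
  ... | ps , refl = begin
    ∣ liftCover t T ∣  ≡⟨ ∣liftCover∣ t T ⟩
    suc t * ∣ T ∣      ≤⟨ m*c≤∣concat∣ ps (λ s → minT _ (layer-isTwinCover {b} {ps} coverS s)) ⟩
    ∣ concat ps ∣      ≤⟨ ∣p∣≤∣x∷p∣ b (concat ps) ⟩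
    ∣ b ∷ concat ps ∣  ∎
    where open ≤-Reasoning

lemma5 : ∀ {n} (G : Graph n) → NoIsolated G → (T : Subset n) → IsMinTwinCover (adj G) T → (t : ℕ) → IsMinTwinCover (muAdj t G) (liftCover t T) × ∣ liftCover t T ∣ ≡ suc t * ∣ T ∣
lemma5 G noIsolated T (coverT , minT) t =
  (liftCover-isTwinCover G t noIsolated coverT , liftCover-minimum G t {T} minT) , ∣liftCover∣ t T
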